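{- Let $G$ be a finite abelian group of order $n$ (identity $e$) such that the generalized dihedral group $D(G)$ is non-abelian, let $r\ge1$ satisfy $2^r=|\{g\in G:g^2=e\}|$ (i.e. the center of $D(G)$ has at least $2$ elements), write $b=n/2^r$, and let $\Gamma=\mathfrak{C}(D(G),D(G))$. Then the resolving polynomial of $\Gamma$ is \[\beta(\Gamma,x)=(n-2^r)(2^r)^{b+1}x^{2n-b-2}+\sum_{i=2n-b-1}^{2n-2}s_ix^{i}+2nx^{2n-1}+x^{2n},\] where for $2n-b-1\le i\le 2n-2$, \[s_i=(n-2^r)(2^r)^{2n-i-1}\binom{b+1}{2n-i-1}+(2^r)^{2n-i}\binom{b+1}{2n-i}.\]
   Context: $D(G)=G\rtimes C_2$, $C_2=\{1,-1\}$, has elements $(g,c)$ with multiplication $(g_1,c_1)(g_2,c_2)=(g_1g_2^{c_1},c_1c_2)$; its center is $\{(g,1):g^2=e\}$, of size $2^r$. The commuting graph $\mathfrak{C}(D(G),D(G))$ is the simple graph with vertex set $D(G)$ in which distinct $u,v$ are adjacent iff $uv=vu$. A set $W$ of vertices of a connected graph is resolving if every vertex is uniquely determined by its vector of shortest-path distances to the vertices of $W$; $\beta(\Gamma)$ is the minimum size of a resolving set. The resolving polynomial is $\beta(\Gamma,x)=\sum_{i=\beta(\Gamma)}^{|V(\Gamma)|}s_ix^i$, where $s_i$ is the number of resolving sets of cardinality $i$. -}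

module Defs where

open import Data.Nat using (ℕ; zero; suc; _+_; _≤_)
open import Data.Fin using (Fin)
open import Data.Fin.Subset using (Subset; _∈_; ∣_∣)
open import Data.Product using (Σ; _×_; _,_)
open import Data.Sign using (Sign) renaming (_*_ to _*ₛ_; + to pos; - to neg)
open import Data.List using (List; length)
open import Data.List.Relation.Unary.Unique.Propositional using (Unique)
import Data.List.Membership.Propositional as LM
open import Function.Bundles using (_⇔_)
open import Relation.Binary.PropositionalEquality using (_≡_)
open import Relation.Nullary using (¬_)

NumberOf : {A : Set} → (A → Set) → ℕ → Set
NumberOf {A} P k =
  Σ (List A) λ xs → Unique xs × (∀ x → (x LM.∈ xs) ⇔ P x) × length xs ≡ k

module Dihedral {n : ℕ} (_∙_ : Fin n → Fin n → Fin n) (_⁻¹ : Fin n → Fin n) where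

  -- elements of D(G) = G ⋊ C₂ ; pos (Sign.+) is 1, neg (Sign.-) is -1
  DG : Set
  DG = Fin n × Sign

  pw : Fin n → Sign → Fin n
  pw g pos = g
  pw g neg = g ⁻¹

  _·_ : DG → DG → DG
  (g₁ , c₁) · (g₂ , c₂) = (g₁ ∙ pw g₂ c₁ , c₁ *ₛ c₂)

  Adj : DG → DG → Set
  Adj u v = ¬ (u ≡ v) × (u · v ≡ v · u)

  data Walk : DG → DG → ℕ → Set where
    nil  : ∀ {u} → Walk u u zero
    cons : ∀ {u v w k} → Adj u v → Walk v w k → Walk u w (suc k)

  IsDist : DG → DG → ℕ → Set
  IsDist u v d = Walk u v d × (∀ m → Walk u v m → d ≤ m)

  -- subsets of D(G): W = (A , B) with (g,1) ∈ W ⇔ g ∈ A, (g,-1) ∈ W ⇔ g ∈ B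
  SubsetDG : Set
  SubsetDG = Subset n × Subset n

  _∈W_ : DG → SubsetDG → Set
  (g , pos) ∈W (A , B) = g ∈ A
  (g , neg) ∈W (A , B) = g ∈ B

  sizeW : SubsetDG → ℕ
  sizeW (A , B) = (∣ A ∣) + (∣ B ∣)

  Resolving : SubsetDG → Set
  Resolving W = ∀ u v →
    (∀ w → w ∈W W → ∀ d → IsDist u w d ⇔ IsDist v w d) → u ≡ v

  NumResolving : ℕ → ℕ → Set
  NumResolving i s = NumberOf (λ W → Resolving W × sizeW W ≡ i) s

module Submission where

-- Let Ω = {g : g² = e}, q = |Ω| = 2^r, m = n − q and b = n / q.  The vertex
-- (e , 1) is adjacent to every other vertex, so distances in Γ are 0, 1 or 2,
-- and for u ≠ w the distance is 1 exactly when u and w commute.  Vertices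
-- commuting with the same vertices are twins; a key sorts them into classes:
-- the m rotations outside Ω, the q rotations in Ω, and, for each of the b
-- cosets of Ω, the q reflections over it.  If Ω ≠ {e} and Ω ≠ G, a set is
-- resolving iff its complement meets every twin class at most once.  So
-- complementation turns resolving sets of size i into partial transversals of
-- size j = 2n − i of a partition with class sizes m, q, …, q (b + 1 times q),
-- and these are counted by e_j (m , q , … , q) = m q^(j−1) C(b+1,j−1) + q^j C(b+1,j).

open import Defs
open import Data.Nat using (ℕ; suc; _+_; _*_; _∸_; _^_; _≤_; _<_)
open import Data.Nat.Combinatorics using (_C_)
open import Data.Fin using (Fin)
open import Data.Product using (_×_)
open import Algebra.Structures using (IsAbelianGroup)
open import Relation.Binary.PropositionalEquality using (_≡_)
open import Relation.Nullary using (¬_)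

open import Algebra.Bundles using (AbelianGroup)
import Algebra.Properties.AbelianGroup as AbelianGroupProperties
import Algebra.Properties.CommutativeSemigroup as CommutativeSemigroupProperties
import Algebra.Properties.Quasigroup as QuasigroupProperties
open import Data.Bool using (Bool; true; false; not; if_then_else_)
import Data.Bool as Bool
open import Data.Empty using (⊥-elim) renaming (⊥ to Empty)
open import Data.Fin using (zero; suc; toℕ; inject; fromℕ<)
import Data.Fin.Properties as FinP
open import Data.Fin.Subset using (Subset; ∣_∣; ∁) renaming (⊥ to ⊥ₛ)
open import Data.Fin.Subset.Properties using (∣∁p∣≡n∸∣p∣; ∣p∣≤n; ∣⊥∣≡0)
open import Data.List using (List; []; _∷_; length; map; _++_; filter; cartesianProduct; allFin)
open import Data.List.Properties using (length-map; length-++; length-tabulate)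
open import Data.List.Membership.Propositional using (_∈_)
open import Data.List.Membership.Propositional.Properties
  using (∈-map⁺; ∈-map⁻; ∈-++⁺ˡ; ∈-++⁺ʳ; ∈-++⁻; ∈-cartesianProduct⁺; ∈-cartesianProduct⁻;
         ∈-filter⁺; ∈-filter⁻; ∈-allFin)
open import Data.List.Membership.Propositional.Properties.WithK using (unique∧set⇒bag)
open import Data.List.Relation.Binary.BagAndSetEquality using (∼bag⇒↭)
open import Data.List.Relation.Binary.Permutation.Propositional.Properties using (↭-length)
open import Data.List.Relation.Unary.All as All using (All)
open import Data.List.Relation.Unary.All.Properties using () renaming (map⁺ to All-map⁺)
open import Data.List.Relation.Unary.AllPairs using ([]; _∷_)
open import Data.List.Relation.Unary.Any using (here; there)
open import Data.List.Relation.Unary.Unique.Propositional using (Unique)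
import Data.List.Relation.Unary.Unique.Propositional.Properties as UniqueP
open import Data.Nat using (zero; z≤n; s≤s)
import Data.Nat as ℕ
open import Data.Nat.Combinatorics using (nCk+nC[k+1]≡[n+1]C[k+1]; nCn≡1; nC1≡n; k>n⇒nCk≡0)
import Data.Nat.Properties as ℕP
open import Data.Nat.Tactic.RingSolver using (solve-∀)
open import Data.Product using (Σ; ∃; _,_; proj₁; proj₂)
import Data.Product.Properties as ProdP
open import Data.Sign using (Sign) renaming (+ to pos; - to neg)
import Data.Sign.Properties as SignP
open import Data.Sum using (_⊎_; inj₁; inj₂)
open import Data.Unit using (⊤; tt)
open import Data.Vec using (_∷_; lookup; _[_]≔_)
open import Data.Vec.Properties
  using (lookup∘update; lookup∘update′; lookup-replicate; lookup-map; tabulate∘lookup; tabulate-cong;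
         []=⇒lookup; lookup⇒[]=)
open import Function.Bundles using (_⇔_; mk⇔; Equivalence)
open import Level using (0ℓ)
open import Relation.Binary using (DecidableEquality; tri<; tri≈; tri>)
open import Relation.Binary.PropositionalEquality using (refl; sym; trans; cong; cong₂; subst; module ≡-Reasoning)
open import Relation.Nullary using (Dec; yes; no; ¬?; does)
open import Relation.Nullary.Decidable using (decidable-stable; _×-dec_)
open import Relation.Unary using (Decidable)

open Equivalence using (to; from)

module Counting where

  -- The number of elements satisfying P is well defined: two duplicate-free
  -- enumerations of the same set are permutations of each other.
  count-unique : {A : Set} {P : A → Set} {k l : ℕ} → NumberOf P k → NumberOf P l → k ≡ l
  count-unique (xs , u , mem , refl) (ys , v , mem′ , refl) =
    ↭-length (∼bag⇒↭ (unique∧set⇒bag u v (λ {a} →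
      mk⇔ (λ a∈ → from (mem′ a) (to (mem a) a∈)) (λ a∈ → from (mem a) (to (mem′ a) a∈)))))

  count-cong : {A : Set} {P Q : A → Set} {k l : ℕ} →
    (∀ a → P a → Q a) → (∀ a → Q a → P a) → k ≡ l → NumberOf P k → NumberOf Q l
  count-cong pq qp refl (xs , u , mem , len) =
    xs , u , (λ a → mk⇔ (λ a∈ → pq a (to (mem a) a∈)) (λ q → from (mem a) (qp a q))) , len

  count-bijection : {A B : Set} {P : A → Set} {Q : B → Set} {k : ℕ} (f : A → B) →
    (∀ a → P a → Q (f a)) →
    (∀ a a′ → P a → P a′ → f a ≡ f a′ → a ≡ a′) →
    (∀ b → Q b → Σ A λ a → P a × f a ≡ b) →
    NumberOf P k → NumberOf Q k
  count-bijection {P = P} {Q} f pres inj surj (xs , u , mem , len) =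
    map f xs , map-unique xs (All.tabulate (λ {a} → to (mem a))) u ,
    (λ b → mk⇔ (image b) (preimage b)) , trans (length-map f xs) len
    where
    map-unique : (ys : List _) → All P ys → Unique ys → Unique (map f ys)
    map-unique [] _ _ = []
    map-unique (y ∷ ys) (py All.∷ pys) (y∉ ∷ u′) =
      All-map⁺ (All.zipWith (λ { (py′ , y≢) fy≡ → y≢ (inj _ _ py py′ fy≡) }) (pys , y∉))
        ∷ map-unique ys pys u′
    image : ∀ b → b ∈ map f xs → Q b
    image b b∈ with ∈-map⁻ f b∈
    ... | a , a∈ , refl = pres a (to (mem a) a∈)
    preimage : ∀ b → Q b → b ∈ map f xs
    preimage b qb with surj b qb
    ... | a , pa , refl = ∈-map⁺ f (from (mem a) pa)

  count-union : {A : Set} {P Q : A → Set} {k l : ℕ} → (∀ a → P a → Q a → Empty) →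
    NumberOf P k → NumberOf Q l → NumberOf (λ a → P a ⊎ Q a) (k + l)
  count-union disjoint (xs , u , mem , len) (ys , v , mem′ , len′) =
    xs ++ ys ,
    UniqueP.++⁺ u v (λ (a∈xs , a∈ys) → disjoint _ (to (mem _) a∈xs) (to (mem′ _) a∈ys)) ,
    (λ a → mk⇔ (split a) (join a)) , trans (length-++ xs) (cong₂ _+_ len len′)
    where
    split : ∀ a → a ∈ xs ++ ys → _
    split a a∈ with ∈-++⁻ xs a∈
    ... | inj₁ a∈xs = inj₁ (to (mem a) a∈xs)
    ... | inj₂ a∈ys = inj₂ (to (mem′ a) a∈ys)
    join : ∀ a → _ → a ∈ xs ++ ys
    join a (inj₁ p) = ∈-++⁺ˡ (from (mem a) p)
    join a (inj₂ q) = ∈-++⁺ʳ xs (from (mem′ a) q)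

  count-product : {A B : Set} {P : A → Set} {Q : B → Set} {k l : ℕ} →
    NumberOf P k → NumberOf Q l → NumberOf (λ ab → P (proj₁ ab) × Q (proj₂ ab)) (k * l)
  count-product (xs , u , mem , len) (ys , v , mem′ , len′) =
    cartesianProduct xs ys , UniqueP.cartesianProduct⁺ u v ,
    (λ (a , b) → mk⇔
      (λ ab∈ → let (a∈ , b∈) = ∈-cartesianProduct⁻ xs ys ab∈ in to (mem a) a∈ , to (mem′ b) b∈)
      (λ (p , q) → ∈-cartesianProduct⁺ (from (mem a) p) (from (mem′ b) q))) ,
    trans (length-product xs ys) (cong₂ _*_ len len′)
    where
    length-product : {A B : Set} (xs : List A) (ys : List B) →
      length (cartesianProduct xs ys) ≡ length xs * length ys
    length-product [] ys = refl
    length-product (x ∷ xs) ys =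
      trans (length-++ (map (x ,_) ys)) (cong₂ _+_ (length-map (x ,_) ys) (length-product xs ys))

  count-none : {A : Set} {P : A → Set} → (∀ a → ¬ P a) → NumberOf P 0
  count-none none = [] , [] , (λ a → mk⇔ (λ ()) (λ p → ⊥-elim (none a p))) , refl

  count-one : {A : Set} {P : A → Set} (x : A) → P x → (∀ a → P a → a ≡ x) → NumberOf P 1
  count-one x px only = (x ∷ []) , (All.[] ∷ []) , (λ a → mk⇔ (λ { (here refl) → px }) (λ p → here (only a p))) , refl

  another : {A : Set} {P : A → Set} {k : ℕ} → DecidableEquality A → NumberOf P k → 2 ≤ k →
    ∀ x → Σ A λ y → P y × ¬ y ≡ x
  another _≟_ ((a ∷ c ∷ _) , (a∉ ∷ _) , mem , _) _ x with a ≟ x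
  ... | yes refl = c , to (mem c) (there (here refl)) , λ c≡a → All.head a∉ (sym c≡a)
  ... | no a≢x = a , to (mem a) (here refl) , a≢x
  another _≟_ ([] , _ , _ , refl) () x
  another _≟_ ((a ∷ []) , _ , _ , refl) (s≤s ()) x

  count-all-Fin : (n : ℕ) → NumberOf {Fin n} (λ _ → ⊤) n
  count-all-Fin n =
    allFin n , UniqueP.allFin⁺ n , (λ a → mk⇔ (λ _ → tt) (λ _ → ∈-allFin a)) , length-tabulate {n = n} (λ i → i)

  count-decidable : {A : Set} {N : ℕ} {P : A → Set} → NumberOf {A} (λ _ → ⊤) N → Decidable P →
    Σ ℕ λ k → NumberOf P k
  count-decidable (xs , u , mem , _) P? =
    length (filter P? xs) , filter P? xs , UniqueP.filter⁺ P? u ,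
    (λ a → mk⇔ (λ a∈ → proj₂ (∈-filter⁻ P? {xs = xs} a∈)) (∈-filter⁺ P? (from (mem a) tt))) , refl

module Subsets (n : ℕ) where

  Elt : Set
  Elt = Fin n × Sign

  Sub : Set
  Sub = Subset n × Subset n

  _≟_ : DecidableEquality Elt
  _≟_ = ProdP.≡-dec FinP._≟_ SignP._≟_

  any? : {P : Elt → Set} → Decidable P → Dec (∃ P)
  any? P? with FinP.any? (λ g → P? (g , pos)) | FinP.any? (λ g → P? (g , neg))
  ... | yes (g , p) | _ = yes ((g , pos) , p)
  ... | no _ | yes (g , p) = yes ((g , neg) , p)
  ... | no none₊ | no none₋ = no λ { ((g , pos) , p) → none₊ (g , p) ; ((g , neg) , p) → none₋ (g , p) }

  member : Sub → Elt → Bool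
  member (A , B) (g , pos) = lookup A g
  member (A , B) (g , neg) = lookup B g

  size : Sub → ℕ
  size (A , B) = ∣ A ∣ + ∣ B ∣

  member-ext : ∀ W W′ → (∀ x → member W x ≡ member W′ x) → W ≡ W′
  member-ext (A , B) (A′ , B′) same = cong₂ _,_ (vec-ext (λ g → same (g , pos))) (vec-ext (λ g → same (g , neg)))
    where
    vec-ext : {v w : Subset n} → (∀ g → lookup v g ≡ lookup w g) → v ≡ w
    vec-ext {v} {w} eq = trans (sym (tabulate∘lookup v)) (trans (tabulate-cong eq) (tabulate∘lookup w))

  update : Sub → Elt → Bool → Sub
  update (A , B) (g , pos) s = A [ g ]≔ s , B
  update (A , B) (g , neg) s = A , B [ g ]≔ s

  member-update-same : ∀ W x s → member (update W x s) x ≡ s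
  member-update-same (A , B) (g , pos) s = lookup∘update g A s
  member-update-same (A , B) (g , neg) s = lookup∘update g B s

  member-update-other : ∀ W x y s → ¬ x ≡ y → member (update W x s) y ≡ member W y
  member-update-other (A , B) (g , pos) (h , pos) s x≢y = lookup∘update′ (λ h≡g → x≢y (cong (_, pos) (sym h≡g))) A s
  member-update-other (A , B) (g , pos) (h , neg) s x≢y = refl
  member-update-other (A , B) (g , neg) (h , pos) s x≢y = refl
  member-update-other (A , B) (g , neg) (h , neg) s x≢y = lookup∘update′ (λ h≡g → x≢y (cong (_, neg) (sym h≡g))) B s

  private
    size-add : {m : ℕ} (v : Subset m) (i : Fin m) → lookup v i ≡ false → ∣ v [ i ]≔ true ∣ ≡ suc ∣ v ∣
    size-add (false ∷ v) zero _ = refl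
    size-add (true ∷ v) (suc i) v[i]≡false = cong suc (size-add v i v[i]≡false)
    size-add (false ∷ v) (suc i) v[i]≡false = size-add v i v[i]≡false

    size-drop : {m : ℕ} (v : Subset m) (i : Fin m) → lookup v i ≡ true → suc ∣ v [ i ]≔ false ∣ ≡ ∣ v ∣
    size-drop (true ∷ v) zero _ = refl
    size-drop (true ∷ v) (suc i) v[i]≡true = cong suc (size-drop v i v[i]≡true)
    size-drop (false ∷ v) (suc i) v[i]≡true = size-drop v i v[i]≡true

    size-nonempty : {m c : ℕ} (v : Subset m) → ∣ v ∣ ≡ suc c → Σ (Fin m) λ i → lookup v i ≡ true
    size-nonempty (true ∷ v) _ = zero , refl
    size-nonempty (false ∷ v) eq = let (i , v[i]) = size-nonempty v eq in suc i , v[i]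

  size-insert : ∀ W x → member W x ≡ false → size (update W x true) ≡ suc (size W)
  size-insert (A , B) (g , pos) absent = cong (_+ ∣ B ∣) (size-add A g absent)
  size-insert (A , B) (g , neg) absent = trans (cong (∣ A ∣ +_) (size-add B g absent)) (ℕP.+-suc ∣ A ∣ ∣ B ∣)

  size-delete : ∀ W x → member W x ≡ true → suc (size (update W x false)) ≡ size W
  size-delete (A , B) (g , pos) present = cong (_+ ∣ B ∣) (size-drop A g present)
  size-delete (A , B) (g , neg) present = trans (sym (ℕP.+-suc ∣ A ∣ _)) (cong (∣ A ∣ +_) (size-drop B g present))

  size-suc⇒member : ∀ {c} W → size W ≡ suc c → Σ Elt λ x → member W x ≡ true
  size-suc⇒member {c} (A , B) eq with ∣ A ∣ in eqA
  ... | suc a = let (g , present) = size-nonempty {c = a} A eqA in (g , pos) , present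
  ... | zero = let (g , present) = size-nonempty {c = c} B eq in (g , neg) , present

  size-zero⇒no-member : ∀ W → size W ≡ 0 → ∀ x → member W x ≡ false
  size-zero⇒no-member W empty x with member W x in present
  ... | false = refl
  ... | true = impossible (trans (size-delete W x present) empty)
    where
    impossible : {k : ℕ} → suc k ≡ 0 → true ≡ false
    impossible ()

  ∅ : Sub
  ∅ = ⊥ₛ , ⊥ₛ

  member-∅ : ∀ x → member ∅ x ≡ false
  member-∅ (g , pos) = lookup-replicate g false
  member-∅ (g , neg) = lookup-replicate g false

  size-∅ : size ∅ ≡ 0
  size-∅ = cong₂ _+_ (∣⊥∣≡0 n) (∣⊥∣≡0 n)

  member-insert : ∀ W x y → member (update W x true) y ≡ true → x ≡ y ⊎ member W y ≡ true
  member-insert W x y y∈ with x ≟ y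
  ... | yes x≡y = inj₁ x≡y
  ... | no x≢y = inj₂ (trans (sym (member-update-other W x y true x≢y)) y∈)

  member-delete : ∀ W x y → member (update W x false) y ≡ true → ¬ x ≡ y × member W y ≡ true
  member-delete W x y y∈ with x ≟ y
  ... | yes refl = ⊥-elim (true≢false (trans (sym y∈) (member-update-same W x false)))
    where
    true≢false : true ≡ false → Empty
    true≢false ()
  ... | no x≢y = x≢y , trans (sym (member-update-other W x y false x≢y)) y∈

  insert-delete : ∀ W x → member W x ≡ true → update (update W x false) x true ≡ W
  insert-delete W x x∈ = member-ext _ W λ y → case y
    where
    case : ∀ y → member (update (update W x false) x true) y ≡ member W y
    case y with x ≟ y
    ... | yes refl = trans (member-update-same _ x true) (sym x∈)
    ... | no x≢y = trans (member-update-other _ x y true x≢y) (member-update-other W x y false x≢y)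

  insert-injective : ∀ W W′ x → member W x ≡ false → member W′ x ≡ false →
    update W x true ≡ update W′ x true → W ≡ W′
  insert-injective W W′ x x∉W x∉W′ same = member-ext W W′ λ y → case y
    where
    case : ∀ y → member W y ≡ member W′ y
    case y with x ≟ y
    ... | yes refl = trans x∉W (sym x∉W′)
    ... | no x≢y = trans (sym (member-update-other W x y true x≢y))
                     (trans (cong (λ V → member V y) same) (member-update-other W′ x y true x≢y))

  complement : Sub → Sub
  complement (A , B) = ∁ A , ∁ B

  member-complement : ∀ W x → member (complement W) x ≡ not (member W x)
  member-complement (A , B) (g , pos) = lookup-map g not A
  member-complement (A , B) (g , neg) = lookup-map g not B

  complement-involutive : ∀ W → complement (complement W) ≡ W
  complement-involutive W = member-ext _ W λ x →
    trans (member-complement (complement W) x) (trans (cong not (member-complement W x)) (not-not (member W x)))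
    where
    not-not : ∀ s → not (not s) ≡ s
    not-not true = refl
    not-not false = refl

  complement-injective : ∀ W W′ → complement W ≡ complement W′ → W ≡ W′
  complement-injective W W′ same =
    trans (sym (complement-involutive W)) (trans (cong complement same) (complement-involutive W′))

  outside-complement : ∀ W x → member (complement W) x ≡ false → member W x ≡ true
  outside-complement W x x∉ = not-false (trans (sym (member-complement W x)) x∉)
    where
    not-false : ∀ {s} → not s ≡ false → s ≡ true
    not-false {true} _ = refl

  inside-complement : ∀ W x → member (complement W) x ≡ true → member W x ≡ false
  inside-complement W x x∈ = not-true (trans (sym (member-complement W x)) x∈)
    where
    not-true : ∀ {s} → not s ≡ true → s ≡ false
    not-true {false} _ = refl

  size-complement : ∀ W → size (complement W) + size W ≡ n + n
  size-complement (A , B) = begin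
      (∣ ∁ A ∣ + ∣ ∁ B ∣) + (∣ A ∣ + ∣ B ∣)
    ≡⟨ cong₂ (λ a b → (a + b) + (∣ A ∣ + ∣ B ∣)) (∣∁p∣≡n∸∣p∣ A) (∣∁p∣≡n∸∣p∣ B) ⟩
      ((n ∸ ∣ A ∣) + (n ∸ ∣ B ∣)) + (∣ A ∣ + ∣ B ∣)
    ≡⟨ interchange (n ∸ ∣ A ∣) (n ∸ ∣ B ∣) ∣ A ∣ ∣ B ∣ ⟩
      ((n ∸ ∣ A ∣) + ∣ A ∣) + ((n ∸ ∣ B ∣) + ∣ B ∣)
    ≡⟨ cong₂ _+_ (ℕP.m∸n+n≡m (∣p∣≤n A)) (ℕP.m∸n+n≡m (∣p∣≤n B)) ⟩
      n + n ∎
    where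
    open ≡-Reasoning
    interchange : ∀ a b c d → (a + b) + (c + d) ≡ (a + c) + (b + d)
    interchange = solve-∀

-- Partial transversals of a partition are counted by elementary
-- symmetric functions of the class sizes

esym : (ℕ → ℕ) → ℕ → ℕ → ℕ
esym f M zero = 1
esym f zero (suc c) = 0
esym f (suc M) (suc c) = esym f M (suc c) + f M * esym f M c

total : (ℕ → ℕ) → ℕ → ℕ
total f zero = 0
total f (suc M) = total f M + f M

-- The classes are the fibres κ⁻¹(k) of a key κ; class k has f k elements.
module Transversals {n : ℕ} (κ : Subsets.Elt n → ℕ) (f : ℕ → ℕ)
                    (class-size : ∀ k → NumberOf (λ x → κ x ≡ k) (f k)) where

  open Subsets n
  open Counting

  Transversal : ℕ → ℕ → Sub → Set
  Transversal M c W = (∀ x → member W x ≡ true → κ x < M)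
                    × (∀ x y → member W x ≡ true → member W y ≡ true → κ x ≡ κ y → x ≡ y)
                    × size W ≡ c

  Meets : ℕ → Sub → Set
  Meets M W = Σ Elt λ x → member W x ≡ true × κ x ≡ M

  count-empty-transversals : ∀ M → NumberOf (Transversal M 0) 1
  count-empty-transversals M =
    count-one ∅ ((λ x x∈ → absurd x x∈) , (λ x y x∈ _ _ → absurd x x∈) , size-∅)
      (λ W (_ , _ , size≡0) → member-ext W ∅ λ x → trans (size-zero⇒no-member W size≡0 x) (sym (member-∅ x)))
    where
    absurd : {A : Set} (x : Elt) → member ∅ x ≡ true → A
    absurd x x∈ with trans (sym x∈) (member-∅ x)
    ... | ()

  misses : ∀ {M c W x} → κ x ≡ M → Transversal M c W → member W x ≡ false
  misses {W = W} {x} κx≡M (below , _ , _) with member W x in x∈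
  ... | false = refl
  ... | true = ⊥-elim (ℕP.<-irrefl κx≡M (below x x∈))

  extend : ∀ {M c W x} → κ x ≡ M → Transversal M c W → Transversal (suc M) (suc c) (update W x true)
  extend {M} {c} {W} {x} κx≡M T@(below , injective , size≡c) =
    bound , injective′ , trans (size-insert W x (misses κx≡M T)) (cong suc size≡c)
    where
    bound : ∀ y → member (update W x true) y ≡ true → κ y < suc M
    bound y y∈ with member-insert W x y y∈
    ... | inj₁ refl = s≤s (ℕP.≤-reflexive κx≡M)
    ... | inj₂ y∈W = ℕP.m≤n⇒m≤1+n (below y y∈W)
    injective′ : ∀ y z → member (update W x true) y ≡ true → member (update W x true) z ≡ true → κ y ≡ κ z → y ≡ z
    injective′ y z y∈ z∈ κy≡κz with member-insert W x y y∈ | member-insert W x z z∈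
    ... | inj₁ refl | inj₁ refl = refl
    ... | inj₁ refl | inj₂ z∈W = ⊥-elim (ℕP.<-irrefl (trans (sym κy≡κz) κx≡M) (below z z∈W))
    ... | inj₂ y∈W | inj₁ refl = ⊥-elim (ℕP.<-irrefl (trans κy≡κz κx≡M) (below y y∈W))
    ... | inj₂ y∈W | inj₂ z∈W = injective y z y∈W z∈W κy≡κz

  restrict : ∀ {M c W x} → member W x ≡ true → κ x ≡ M →
    Transversal (suc M) (suc c) W → Transversal M c (update W x false)
  restrict {M} {c} {W} {x} x∈ κx≡M (below , injective , size≡) =
    bound ,
    (λ y z y∈ z∈ → injective y z (proj₂ (member-delete W x y y∈)) (proj₂ (member-delete W x z z∈))) ,
    ℕP.suc-injective (trans (size-delete W x x∈) size≡)
    where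
    bound : ∀ y → member (update W x false) y ≡ true → κ y < M
    bound y y∈ = let (x≢y , y∈W) = member-delete W x y y∈ in
      ℕP.≤∧≢⇒< (ℕP.≤-pred (below y y∈W)) (λ κy≡M → x≢y (injective x y x∈ y∈W (trans κx≡M (sym κy≡M))))

  -- transversals below M + 1 meeting class M ≅ (class M) × (transversals below M)
  count-meeting : ∀ {M c k} → NumberOf (Transversal M c) k →
    NumberOf (λ W → Meets M W × Transversal (suc M) (suc c) W) (f M * k)
  count-meeting {M} {c} transversals =
    count-bijection add (λ (x , W) (κx≡M , T) → (x , member-update-same W x true , κx≡M) , extend κx≡M T)
      injective surjective (count-product (class-size M) transversals)
    where
    add : Elt × Sub → Sub
    add (x , W) = update W x true
    injective : ∀ a a′ → κ (proj₁ a) ≡ M × Transversal M c (proj₂ a) →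
      κ (proj₁ a′) ≡ M × Transversal M c (proj₂ a′) → add a ≡ add a′ → a ≡ a′
    injective (x , W) (x′ , W′) (κx , T) (κx′ , T′) same
      with member-insert W x x′ (trans (cong (λ V → member V x′) same) (member-update-same W′ x′ true))
    ... | inj₂ x′∈W = ⊥-elim (ℕP.<-irrefl κx′ (proj₁ T x′ x′∈W))
    ... | inj₁ refl = cong (x ,_) (insert-injective W W′ x (misses κx T) (misses κx′ T′) same)
    surjective : ∀ W → Meets M W × Transversal (suc M) (suc c) W →
      Σ (Elt × Sub) λ a → (κ (proj₁ a) ≡ M × Transversal M c (proj₂ a)) × add a ≡ W
    surjective W ((x , x∈ , κx≡M) , T) = (x , update W x false) , (κx≡M , restrict x∈ κx≡M T) , insert-delete W x x∈

  -- c-element transversals below M + 1 either avoid class M or meet it once,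
  -- which is the recursion of esym
  count-transversals : ∀ M c → NumberOf (Transversal M c) (esym f M c)
  count-transversals M zero = count-empty-transversals M
  count-transversals zero (suc c) =
    count-none λ W (below , _ , size≡) → let (x , x∈) = size-suc⇒member W size≡ in ℕP.n≮0 (below x x∈)
  count-transversals (suc M) (suc c) =
    count-cong merge split refl
      (count-union disjoint (count-transversals M (suc c)) (count-meeting (count-transversals M c)))
    where
    disjoint : ∀ W → Transversal M (suc c) W → Meets M W × Transversal (suc M) (suc c) W → Empty
    disjoint W (below , _) ((x , x∈ , κx≡M) , _) = ℕP.<-irrefl κx≡M (below x x∈)
    merge : ∀ W → Transversal M (suc c) W ⊎ (Meets M W × Transversal (suc M) (suc c) W) → Transversal (suc M) (suc c) W
    merge W (inj₁ (below , rest)) = (λ x x∈ → ℕP.m≤n⇒m≤1+n (below x x∈)) , rest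
    merge W (inj₂ (_ , T)) = T
    split : ∀ W → Transversal (suc M) (suc c) W → Transversal M (suc c) W ⊎ (Meets M W × Transversal (suc M) (suc c) W)
    split W T@(below , rest) with any? (λ x → (member W x Bool.≟ true) ×-dec (κ x ℕP.≟ M))
    ... | yes meets = inj₂ (meets , T)
    ... | no misses-M =
      inj₁ ((λ x x∈ → ℕP.≤∧≢⇒< (ℕP.≤-pred (below x x∈)) (λ κx≡M → misses-M (x , x∈ , κx≡M))) , rest)

  count-below : ∀ M → NumberOf (λ x → κ x < M) (total f M)
  count-below zero = count-none (λ x ())
  count-below (suc M) = count-cong merge split refl
    (count-union (λ x κx<M κx≡M → ℕP.<-irrefl κx≡M κx<M) (count-below M) (class-size M))
    where
    merge : ∀ x → κ x < M ⊎ κ x ≡ M → κ x < suc M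
    merge x (inj₁ κx<M) = ℕP.m≤n⇒m≤1+n κx<M
    merge x (inj₂ κx≡M) = s≤s (ℕP.≤-reflexive κx≡M)
    split : ∀ x → κ x < suc M → κ x < M ⊎ κ x ≡ M
    split x κx≤M with κ x ℕP.≟ M
    ... | yes κx≡M = inj₂ κx≡M
    ... | no κx≢M = inj₁ (ℕP.≤∧≢⇒< (ℕP.≤-pred κx≤M) κx≢M)

module ClosedForm (m q : ℕ) where

  open ≡-Reasoning

  -- e_c (m , q , … , q) with t copies of q
  transversals : ℕ → ℕ → ℕ
  transversals t zero = 1
  transversals t (suc c) = m * q ^ c * (t C c) + q ^ suc c * (t C suc c)

  -- Pascal's rule for transversals: the recursion of esym for one more class of size q
  transversals-pascal : ∀ t c → transversals (suc t) (suc c) ≡ transversals t (suc c) + q * transversals t c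
  transversals-pascal t zero = begin
      m * 1 * 1 + q * 1 * (suc t C 1)
    ≡⟨ cong (λ x → m * 1 * 1 + q * 1 * x) (sym (nCk+nC[k+1]≡[n+1]C[k+1] t 0)) ⟩
      m * 1 * 1 + q * 1 * (1 + t C 1)
    ≡⟨ rearrange m q (t C 1) ⟩
      m * 1 * 1 + q * 1 * (t C 1) + q * 1 ∎
    where
    rearrange : ∀ m q y → m * 1 * 1 + q * 1 * (1 + y) ≡ m * 1 * 1 + q * 1 * y + q * 1
    rearrange = solve-∀
  transversals-pascal t (suc c) = begin
      m * q ^ suc c * (suc t C suc c) + q ^ suc (suc c) * (suc t C suc (suc c))
    ≡⟨ cong₂ (λ x y → m * q ^ suc c * x + q ^ suc (suc c) * y)
         (sym (nCk+nC[k+1]≡[n+1]C[k+1] t c)) (sym (nCk+nC[k+1]≡[n+1]C[k+1] t (suc c))) ⟩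
      m * q ^ suc c * ((t C c) + (t C suc c)) + q ^ suc (suc c) * ((t C suc c) + (t C suc (suc c)))
    ≡⟨ rearrange m q (q ^ c) (t C c) (t C suc c) (t C suc (suc c)) ⟩
      m * q ^ suc c * (t C suc c) + q ^ suc (suc c) * (t C suc (suc c))
        + q * (m * q ^ c * (t C c) + q ^ suc c * (t C suc c)) ∎
    where
    rearrange : ∀ m q p x y z →
      m * (q * p) * (x + y) + q * (q * p) * (y + z) ≡ m * (q * p) * y + q * (q * p) * z + q * (m * p * x + q * p * y)
    rearrange = solve-∀

  esym-closed : (f : ℕ → ℕ) → f 0 ≡ m → (∀ k → f (suc k) ≡ 0 ⊎ f (suc k) ≡ q) →
    ∀ M → Σ ℕ λ t → (∀ c → esym f (suc M) c ≡ transversals t c) × total f (suc M) ≡ m + t * q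
  esym-closed f f0≡m later zero = 0 , first-class , trans f0≡m (sym (ℕP.+-identityʳ m))
    where
    first-class : ∀ c → esym f 1 c ≡ transversals 0 c
    first-class zero = refl
    first-class (suc zero) rewrite f0≡m = one-element m q
      where
      one-element : ∀ m q → m * 1 ≡ m * 1 * 1 + q * 1 * 0
      one-element = solve-∀
    first-class (suc (suc c)) rewrite f0≡m = two-elements m (q ^ suc c) (q ^ suc (suc c))
      where
      two-elements : ∀ m p r → m * 0 ≡ m * p * 0 + r * 0
      two-elements = solve-∀
  esym-closed f f0≡m later (suc M) with esym-closed f f0≡m later M | later M
  ... | t , closed , sum | inj₁ empty = t , step , trans (cong₂ _+_ sum empty) (ℕP.+-identityʳ _)
    where
    step : ∀ c → esym f (suc (suc M)) c ≡ transversals t c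
    step zero = refl
    step (suc c) = trans (cong (λ x → esym f (suc M) (suc c) + x * esym f (suc M) c) empty)
                         (trans (ℕP.+-identityʳ _) (closed (suc c)))
  ... | t , closed , sum | inj₂ full = suc t , step , trans (cong₂ _+_ sum full) (add-class m t q)
    where
    add-class : ∀ m t q → m + t * q + q ≡ m + suc t * q
    add-class = solve-∀
    step : ∀ c → esym f (suc (suc M)) c ≡ transversals (suc t) c
    step zero = refl
    step (suc c) = begin
        esym f (suc M) (suc c) + f (suc M) * esym f (suc M) c
      ≡⟨ cong₂ (λ x y → x + y * esym f (suc M) c) (closed (suc c)) full ⟩
        transversals t (suc c) + q * esym f (suc M) c
      ≡⟨ cong (λ x → transversals t (suc c) + q * x) (closed c) ⟩
        transversals t (suc c) + q * transversals t c
      ≡⟨ transversals-pascal t c ⟨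
        transversals (suc t) (suc c) ∎

  -- the general term, in the shape used by the theorem
  transversals-at : ∀ t j → 1 ≤ j → transversals t j ≡ m * q ^ (j ∸ 1) * (t C (j ∸ 1)) + q ^ j * (t C j)
  transversals-at t (suc c) _ = refl

  transversals-vanish : ∀ t c → suc (suc t) ≤ c → transversals t c ≡ 0
  transversals-vanish t (suc c) (s≤s t<c) = begin
      m * q ^ c * (t C c) + q ^ suc c * (t C suc c)
    ≡⟨ cong₂ (λ x y → m * q ^ c * x + q ^ suc c * y) (k>n⇒nCk≡0 t<c) (k>n⇒nCk≡0 (ℕP.m≤n⇒m≤1+n t<c)) ⟩
      m * q ^ c * 0 + q ^ suc c * 0
    ≡⟨ cong₂ _+_ (ℕP.*-zeroʳ (m * q ^ c)) (ℕP.*-zeroʳ (q ^ suc c)) ⟩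
      0 ∎

  transversals-top : ∀ t → transversals t (suc t) ≡ m * q ^ t
  transversals-top t = begin
      m * q ^ t * (t C t) + q ^ suc t * (t C suc t)
    ≡⟨ cong₂ (λ x y → m * q ^ t * x + q ^ suc t * y) (nCn≡1 t) (k>n⇒nCk≡0 (ℕP.n<1+n t)) ⟩
      m * q ^ t * 1 + q ^ suc t * 0
    ≡⟨ cong₂ _+_ (ℕP.*-identityʳ (m * q ^ t)) (ℕP.*-zeroʳ (q ^ suc t)) ⟩
      m * q ^ t + 0
    ≡⟨ ℕP.+-identityʳ _ ⟩
      m * q ^ t ∎

  transversals-one : ∀ t → transversals t 1 ≡ m + t * q
  transversals-one t = begin
      m * 1 * 1 + q * 1 * (t C 1)
    ≡⟨ cong (λ x → m * 1 * 1 + q * 1 * x) (nC1≡n t) ⟩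
      m * 1 * 1 + q * 1 * t
    ≡⟨ rearrange m q t ⟩
      m + t * q ∎
    where
    rearrange : ∀ m q t → m * 1 * 1 + q * 1 * t ≡ m + t * q
    rearrange = solve-∀

+⇒∸ : ∀ {a s N} → a + s ≡ N → a ≡ N ∸ s
+⇒∸ {a} {s} refl = sym (ℕP.m+n∸n≡m a s)

below-difference : ∀ N k i → i < N ∸ k → i ≤ N × k < N ∸ i
below-difference N k i i<N∸k =
  ℕP.m+n≤o⇒m≤o i i+[1+k]≤N , ℕP.m+n≤o⇒m≤o∸n (suc k) (subst (_≤ N) (ℕP.+-comm i (suc k)) i+[1+k]≤N)
  where
  k<N : k < N
  k<N = ℕP.m∸n≢0⇒n<m (λ N∸k≡0 → ℕP.n≮0 (subst (i <_) N∸k≡0 i<N∸k))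
  i+[1+k]≤N : i + suc k ≤ N
  i+[1+k]≤N = subst (_≤ N) (sym (ℕP.+-suc i k)) (ℕP.m≤o∸n⇒m+n≤o (suc i) (ℕP.<⇒≤ k<N) i<N∸k)

inject-fromℕ< : {n : ℕ} {i i′ : Fin n} (i<i′ : toℕ i ℕ.< toℕ i′) → inject {i = i′} (fromℕ< i<i′) ≡ i
inject-fromℕ< i<i′ = FinP.toℕ-injective (trans (FinP.toℕ-inject (fromℕ< i<i′)) (FinP.toℕ-fromℕ< i<i′))

least-unique : {n : ℕ} {P : Fin n → Set} {y y′ : Fin n} → P y → P y′ →
  (∀ (j : Fin (toℕ y)) → ¬ P (inject j)) → (∀ (j : Fin (toℕ y′)) → ¬ P (inject j)) → y ≡ y′
least-unique {P = P} {y} {y′} py py′ y-least y′-least with FinP.<-cmp y y′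
... | tri≈ _ y≡y′ _ = y≡y′
... | tri< y<y′ _ _ = ⊥-elim (y′-least (fromℕ< y<y′) (subst P (sym (inject-fromℕ< y<y′)) py))
... | tri> _ _ y′<y = ⊥-elim (y-least (fromℕ< y′<y) (subst P (sym (inject-fromℕ< y′<y)) py′))

-- The subgroup Ω = {g : g² = e} of an abelian group and its cosets

module Involutions {n : ℕ} (_∙_ : Fin n → Fin n → Fin n) (e : Fin n) (_⁻¹ : Fin n → Fin n)
                   (isAbelianGroup : IsAbelianGroup _≡_ _∙_ e _⁻¹) where

  group : AbelianGroup 0ℓ 0ℓ
  group = record { isAbelianGroup = isAbelianGroup }

  open IsAbelianGroup isAbelianGroup using (assoc; comm; identityˡ; inverseˡ; inverseʳ)
  open AbelianGroupProperties group using (inverseʳ-unique; ε⁻¹≈ε; ⁻¹-∙-comm; ⁻¹-anti-homo‿-; xyx⁻¹≈y; quasigroup)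
  open QuasigroupProperties quasigroup public using (cancelˡ)
  open ≡-Reasoning

  Ω : Fin n → Set
  Ω x = x ∙ x ≡ e

  Ω? : Decidable Ω
  Ω? x = (x ∙ x) FinP.≟ e

  Ω-e : Ω e
  Ω-e = identityˡ e

  Ω-∙ : ∀ x y → Ω x → Ω y → Ω (x ∙ y)
  Ω-∙ x y x²≡e y²≡e = begin
    (x ∙ y) ∙ (x ∙ y) ≡⟨ interchange x y x y ⟩
    (x ∙ x) ∙ (y ∙ y) ≡⟨ cong₂ _∙_ x²≡e y²≡e ⟩
    e ∙ e             ≡⟨ Ω-e ⟩
    e                 ∎
    where open CommutativeSemigroupProperties (AbelianGroup.commutativeSemigroup group) using (interchange)

  Ω-⁻¹ : ∀ x → Ω x → Ω (x ⁻¹)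
  Ω-⁻¹ x x²≡e = trans (⁻¹-∙-comm x x) (trans (cong _⁻¹ x²≡e) ε⁻¹≈ε)

  Ω-self-inverse : ∀ x → Ω x → x ⁻¹ ≡ x
  Ω-self-inverse x x²≡e = sym (inverseʳ-unique x x x²≡e)

  _~_ : Fin n → Fin n → Set
  g ~ h = Ω (g ∙ (h ⁻¹))

  _~?_ : ∀ g h → Dec (g ~ h)
  g ~? h = Ω? (g ∙ (h ⁻¹))

  ~-refl : ∀ g → g ~ g
  ~-refl g = subst Ω (sym (inverseʳ g)) Ω-e

  ~-sym : ∀ g h → g ~ h → h ~ g
  ~-sym g h g~h = subst Ω (⁻¹-anti-homo‿- g h) (Ω-⁻¹ _ g~h)

  ~-trans : ∀ g h k → g ~ h → h ~ k → g ~ k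
  ~-trans g h k g~h h~k = subst Ω (telescope g h k) (Ω-∙ _ _ g~h h~k)
    where
    telescope : ∀ g h k → (g ∙ (h ⁻¹)) ∙ (h ∙ (k ⁻¹)) ≡ g ∙ (k ⁻¹)
    telescope g h k = begin
      (g ∙ (h ⁻¹)) ∙ (h ∙ (k ⁻¹)) ≡⟨ assoc g (h ⁻¹) _ ⟩
      g ∙ ((h ⁻¹) ∙ (h ∙ (k ⁻¹))) ≡⟨ cong (g ∙_) (sym (assoc _ _ _)) ⟩
      g ∙ (((h ⁻¹) ∙ h) ∙ (k ⁻¹)) ≡⟨ cong (λ z → g ∙ (z ∙ (k ⁻¹))) (inverseˡ h) ⟩
      g ∙ (e ∙ (k ⁻¹))          ≡⟨ cong (g ∙_) (identityˡ _) ⟩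
      g ∙ (k ⁻¹)                ∎

  ~-translate : ∀ h w → Ω w → (h ∙ w) ~ h
  ~-translate h w w∈Ω = subst Ω (sym (xyx⁻¹≈y h w)) w∈Ω

  ~-translate⁻ : ∀ h w → (h ∙ w) ~ h → Ω w
  ~-translate⁻ h w hw~h = subst Ω (xyx⁻¹≈y h w) hw~h

  least : ∀ g → Σ (Fin n) λ y → y ~ g × (∀ (j : Fin (toℕ y)) → ¬ inject j ~ g)
  least g with FinP.¬∀⟶∃¬-smallest n (λ y → ¬ y ~ g) (λ y → ¬? (y ~? g)) (λ none → none g (~-refl g))
  ... | y , ¬¬y~g , smaller = y , decidable-stable (y ~? g) ¬¬y~g , smaller

  rep : Fin n → Fin n
  rep g = proj₁ (least g)

  rep~ : ∀ g → rep g ~ g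
  rep~ g = proj₁ (proj₂ (least g))

  rep-cong : ∀ g h → g ~ h → rep g ≡ rep h
  rep-cong g h g~h =
    least-unique {P = _~ h} (~-trans _ g h (rep~ g) g~h) (rep~ h)
      (λ j j~h → proj₂ (proj₂ (least g)) j (~-trans _ h g j~h (~-sym g h g~h)))
      (proj₂ (proj₂ (least h)))

  rep-injective : ∀ g h → rep g ≡ rep h → g ~ h
  rep-injective g h same = ~-trans g (rep g) h (~-sym _ g (rep~ g)) (subst (_~ h) (sym same) (rep~ h))

-- The commuting graph Γ of D(G): adjacency, distances, twin classes

module CommutingGraph {n : ℕ} (_∙_ : Fin n → Fin n → Fin n) (e : Fin n) (_⁻¹ : Fin n → Fin n)
                      (isAbelianGroup : IsAbelianGroup _≡_ _∙_ e _⁻¹) where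

  open IsAbelianGroup isAbelianGroup using (comm; identityʳ; inverseʳ)
  open Involutions _∙_ e _⁻¹ isAbelianGroup
  open AbelianGroupProperties group using (inverseʳ-unique; ⁻¹-anti-homo‿-)
  open Dihedral _∙_ _⁻¹
  open Subsets n using (member; _≟_)

  member⇒∈W : ∀ W x → member W x ≡ true → x ∈W W
  member⇒∈W (A , B) (g , pos) = lookup⇒[]= g A
  member⇒∈W (A , B) (g , neg) = lookup⇒[]= g B

  ∈W⇒member : ∀ W x → x ∈W W → member W x ≡ true
  ∈W⇒member (A , B) (g , pos) = []=⇒lookup
  ∈W⇒member (A , B) (g , neg) = []=⇒lookup

  Commuting : DG → DG → Set
  Commuting (g , pos) (h , pos) = ⊤
  Commuting (g , pos) (h , neg) = Ω g
  Commuting (g , neg) (h , pos) = Ω h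
  Commuting (g , neg) (h , neg) = g ~ h

  Commute : DG → DG → Set
  Commute u w = u · w ≡ w · u

  commute? : ∀ u w → Dec (Commute u w)
  commute? u w = (u · w) ≟ (w · u)

  private
    first-coordinate : ∀ {a b : Fin n} {s t : Sign} → (a , s) ≡ (b , t) → a ≡ b
    first-coordinate refl = refl

    rotation-reflection⇒Ω : ∀ g h → g ∙ h ≡ h ∙ (g ⁻¹) → Ω g
    rotation-reflection⇒Ω g h gh≡hg⁻¹ =
      trans (cong (g ∙_) (cancelˡ h g (g ⁻¹) (trans (comm h g) gh≡hg⁻¹))) (inverseʳ g)

    Ω⇒rotation-reflection : ∀ g h → Ω g → g ∙ h ≡ h ∙ (g ⁻¹)
    Ω⇒rotation-reflection g h g∈Ω = trans (comm g h) (cong (h ∙_) (sym (Ω-self-inverse g g∈Ω)))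

    quotient-inverse : ∀ g h → (g ∙ (h ⁻¹)) ∙ (h ∙ (g ⁻¹)) ≡ e
    quotient-inverse g h = subst (λ x → (g ∙ (h ⁻¹)) ∙ x ≡ e) (⁻¹-anti-homo‿- g h) (inverseʳ (g ∙ (h ⁻¹)))

  commute⇒Commuting : ∀ u w → Commute u w → Commuting u w
  commute⇒Commuting (g , pos) (h , pos) _ = tt
  commute⇒Commuting (g , pos) (h , neg) uw≡wu = rotation-reflection⇒Ω g h (first-coordinate uw≡wu)
  commute⇒Commuting (g , neg) (h , pos) uw≡wu = rotation-reflection⇒Ω h g (sym (first-coordinate uw≡wu))
  commute⇒Commuting (g , neg) (h , neg) uw≡wu =
    trans (cong ((g ∙ (h ⁻¹)) ∙_) (first-coordinate uw≡wu)) (quotient-inverse g h)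

  Commuting⇒commute : ∀ u w → Commuting u w → Commute u w
  Commuting⇒commute (g , pos) (h , pos) _ = cong (_, pos) (comm g h)
  Commuting⇒commute (g , pos) (h , neg) g∈Ω = cong (_, neg) (Ω⇒rotation-reflection g h g∈Ω)
  Commuting⇒commute (g , neg) (h , pos) h∈Ω = cong (_, neg) (sym (Ω⇒rotation-reflection h g h∈Ω))
  Commuting⇒commute (g , neg) (h , neg) g~h =
    cong (_, pos) (sym (trans (inverseʳ-unique _ _ (quotient-inverse g h)) (Ω-self-inverse _ g~h)))

  Commuting-sym : ∀ u w → Commuting u w → Commuting w u
  Commuting-sym (g , pos) (h , pos) _ = tt
  Commuting-sym (g , pos) (h , neg) c = c
  Commuting-sym (g , neg) (h , pos) c = c
  Commuting-sym (g , neg) (h , neg) g~h = ~-sym g h g~h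

  -- (e , 1) is central, so every two vertices are at distance at most 2
  e-central : ∀ w → Commuting (e , pos) w
  e-central (h , pos) = tt
  e-central (h , neg) = Ω-e

  dist : DG → DG → ℕ
  dist u w with u ≟ w | commute? u w
  ... | yes _ | _ = 0
  ... | no _ | yes _ = 1
  ... | no _ | no _ = 2

  dist-self : ∀ u → dist u u ≡ 0
  dist-self u with u ≟ u
  ... | yes _ = refl
  ... | no u≢u = ⊥-elim (u≢u refl)

  dist-0 : ∀ u w → dist u w ≡ 0 → u ≡ w
  dist-0 u w d≡0 with u ≟ w | commute? u w
  ... | yes u≡w | _ = u≡w
  dist-0 u w () | no _ | yes _
  dist-0 u w () | no _ | no _

  dist-1 : ∀ u w → ¬ u ≡ w → Commuting u w → dist u w ≡ 1
  dist-1 u w u≢w c with u ≟ w | commute? u w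
  ... | yes u≡w | _ = ⊥-elim (u≢w u≡w)
  ... | no _ | yes _ = refl
  ... | no _ | no ¬uw≡wu = ⊥-elim (¬uw≡wu (Commuting⇒commute u w c))

  dist-2 : ∀ u w → ¬ u ≡ w → ¬ Commuting u w → dist u w ≡ 2
  dist-2 u w u≢w ¬c with u ≟ w | commute? u w
  ... | yes u≡w | _ = ⊥-elim (u≢w u≡w)
  ... | no _ | yes uw≡wu = ⊥-elim (¬c (commute⇒Commuting u w uw≡wu))
  ... | no _ | no _ = refl

  dist-is-distance : ∀ u w → IsDist u w (dist u w)
  dist-is-distance u w with u ≟ w | commute? u w
  ... | yes refl | _ = nil , (λ _ _ → z≤n)
  ... | no u≢w | yes uw≡wu = cons (u≢w , uw≡wu) nil , at-least-1
    where
    at-least-1 : ∀ k → Walk u w k → 1 ≤ k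
    at-least-1 zero nil = ⊥-elim (u≢w refl)
    at-least-1 (suc k) _ = s≤s z≤n
  ... | no u≢w | no ¬uw≡wu = cons (u≢e , via-e u) (cons (e≢w , via-e′ w) nil) , at-least-2
    where
    via-e : ∀ x → Commute x (e , pos)
    via-e x = Commuting⇒commute x _ (Commuting-sym _ x (e-central x))
    via-e′ : ∀ x → Commute (e , pos) x
    via-e′ x = Commuting⇒commute _ x (e-central x)
    u≢e : ¬ u ≡ (e , pos)
    u≢e refl = ¬uw≡wu (via-e′ w)
    e≢w : ¬ (e , pos) ≡ w
    e≢w refl = ¬uw≡wu (via-e u)
    at-least-2 : ∀ k → Walk u w k → 2 ≤ k
    at-least-2 zero nil = ⊥-elim (u≢w refl)
    at-least-2 (suc zero) (cons adjacent nil) = ⊥-elim (¬uw≡wu (proj₂ adjacent))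
    at-least-2 (suc (suc k)) _ = s≤s (s≤s z≤n)

  IsDist⇒dist : ∀ u w d → IsDist u w d → d ≡ dist u w
  IsDist⇒dist u w d (walk , shortest) =
    ℕP.≤-antisym (shortest _ (proj₁ (dist-is-distance u w))) (proj₂ (dist-is-distance u w) d walk)

  equal-dist⇒same-profile : ∀ W u v → (∀ w → member W w ≡ true → dist u w ≡ dist v w) →
    ∀ w → w ∈W W → ∀ d → IsDist u w d ⇔ IsDist v w d
  equal-dist⇒same-profile W u v same w w∈ d = mk⇔
    (λ du → subst (IsDist v w) (sym (trans (IsDist⇒dist u w d du) (same w (∈W⇒member W w w∈)))) (dist-is-distance v w))
    (λ dv → subst (IsDist u w) (sym (trans (IsDist⇒dist v w d dv) (sym (same w (∈W⇒member W w w∈))))) (dist-is-distance u w))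

  same-profile⇒equal-dist : ∀ W u v → (∀ w → w ∈W W → ∀ d → IsDist u w d ⇔ IsDist v w d) →
    ∀ w → member W w ≡ true → dist u w ≡ dist v w
  same-profile⇒equal-dist W u v same w w∈ =
    IsDist⇒dist v w _ (to (same w (member⇒∈W W w w∈) (dist u w)) (dist-is-distance u w))

  -- The twin key: vertices with equal keys have the same neighbours.  Key 0
  -- collects the rotations outside Ω, key 1 the rotations in Ω (the centre),
  -- and key 2 + toℕ (rep g) the reflections over the coset of g.
  key : DG → ℕ
  key (g , pos) = if does (Ω? g) then 1 else 0
  key (g , neg) = 2 + toℕ (rep g)

  key-Ω : ∀ g → Ω g → key (g , pos) ≡ 1
  key-Ω g g∈Ω with Ω? g
  ... | yes _ = refl
  ... | no g∉Ω = ⊥-elim (g∉Ω g∈Ω)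

  key-¬Ω : ∀ g → ¬ Ω g → key (g , pos) ≡ 0
  key-¬Ω g g∉Ω with Ω? g
  ... | yes g∈Ω = ⊥-elim (g∉Ω g∈Ω)
  ... | no _ = refl

  key-rotation≤1 : ∀ g → key (g , pos) ≤ 1
  key-rotation≤1 g with Ω? g
  ... | yes _ = s≤s z≤n
  ... | no _ = z≤n

  key-rotation≢reflection : ∀ g h → ¬ key (g , pos) ≡ key (h , neg)
  key-rotation≢reflection g h same with ℕP.≤-trans (ℕP.≤-reflexive (sym same)) (key-rotation≤1 g)
  ... | s≤s ()

  key-rotation : ∀ g h → key (g , pos) ≡ key (h , pos) → Ω g → Ω h
  key-rotation g h same g∈Ω with Ω? h
  ... | yes h∈Ω = h∈Ω
  ... | no _ with trans (sym (key-Ω g g∈Ω)) same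
  ...   | ()

  key-reflection : ∀ g h → key (g , neg) ≡ key (h , neg) → g ~ h
  key-reflection g h same = rep-injective g h (FinP.toℕ-injective (ℕP.suc-injective (ℕP.suc-injective same)))

  key-reflection⁻ : ∀ g h → g ~ h → key (g , neg) ≡ key (h , neg)
  key-reflection⁻ g h g~h = cong (λ y → 2 + toℕ y) (rep-cong g h g~h)

  twins : ∀ u v w → key u ≡ key v → Commuting u w → Commuting v w
  twins (g , pos) (g′ , pos) (h , pos) _ _ = tt
  twins (g , pos) (g′ , pos) (h , neg) same g∈Ω = key-rotation g g′ same g∈Ω
  twins (g , pos) (g′ , neg) w same _ = ⊥-elim (key-rotation≢reflection g g′ same)
  twins (g , neg) (g′ , pos) w same _ = ⊥-elim (key-rotation≢reflection g′ g (sym same))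
  twins (g , neg) (g′ , neg) (h , pos) _ h∈Ω = h∈Ω
  twins (g , neg) (g′ , neg) (h , neg) same g~h = ~-trans g′ g h (~-sym g g′ (key-reflection g g′ same)) g~h

  twins-dist : ∀ u v w → key u ≡ key v → ¬ u ≡ w → ¬ v ≡ w → dist u w ≡ dist v w
  twins-dist u v w same u≢w v≢w = by-cases (commute? u w)
    where
    by-cases : Dec (Commute u w) → dist u w ≡ dist v w
    by-cases (yes uw≡wu) = trans (dist-1 u w u≢w c) (sym (dist-1 v w v≢w (twins u v w same c)))
      where
      c : Commuting u w
      c = commute⇒Commuting u w uw≡wu
    by-cases (no ¬uw≡wu) = trans (dist-2 u w u≢w (λ c → ¬uw≡wu (Commuting⇒commute u w c)))
      (sym (dist-2 v w v≢w (λ c → ¬uw≡wu (Commuting⇒commute u w (twins v u w (sym same) c)))))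

  KeyInjectiveOff : Subsets.Sub n → Set
  KeyInjectiveOff W = ∀ x y → member W x ≡ false → member W y ≡ false → key x ≡ key y → x ≡ y

  private
    outside≢inside : ∀ W x w → member W x ≡ false → member W w ≡ true → ¬ x ≡ w
    outside≢inside W x w x∉ w∈ refl with trans (sym x∉) w∈
    ... | ()

  resolving⇒key-injective : ∀ W → Resolving W → KeyInjectiveOff W
  resolving⇒key-injective W resolving x y x∉ y∉ same =
    resolving x y (equal-dist⇒same-profile W x y λ w w∈ →
      twins-dist x y w same (outside≢inside W x w x∉ w∈) (outside≢inside W y w y∉ w∈))

  -- Conversely, if Ω ≠ {e} and Ω ≠ G, such sets are resolving.
  module _ (ω : Fin n) (ω∈Ω : Ω ω) (ω≢e : ¬ ω ≡ e) (g₀ : Fin n) (g₀∉Ω : ¬ Ω g₀) where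

    -- every coset h Ω has at least the two twin reflections (h , -1) and
    -- (h ω , -1), so W contains a reflection over it
    reflection-over : ∀ W → KeyInjectiveOff W → ∀ h → Σ (Fin n) λ k → member W (k , neg) ≡ true × k ~ h
    reflection-over W injective h with member W (h , neg) in h∈
    ... | true = h , h∈ , ~-refl h
    ... | false with member W ((h ∙ ω) , neg) in hω∈
    ...   | true = (h ∙ ω) , hω∈ , ~-translate h ω ω∈Ω
    ...   | false = ⊥-elim (ω≢e (cancelˡ h ω e (trans (first-coordinate hω≡h) (sym (identityʳ h)))))
      where
      hω≡h : ((h ∙ ω) , neg) ≡ (h , neg)
      hω≡h = injective _ _ hω∈ h∈ (key-reflection⁻ _ _ (~-translate h ω ω∈Ω))

    Separates : DG → DG → DG → Set
    Separates u v w = (Commuting u w × ¬ Commuting v w) ⊎ (¬ Commuting u w × Commuting v w)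

    separates-swap : ∀ {u v w} → Separates u v w → Separates v u w
    separates-swap (inj₁ (cu , ¬cv)) = inj₂ (¬cv , cu)
    separates-swap (inj₂ (¬cu , cv)) = inj₁ (cv , ¬cu)

    separator : ∀ W → KeyInjectiveOff W → ∀ u v → ¬ key u ≡ key v → Σ DG λ w → member W w ≡ true × Separates u v w
    separator W injective (g , pos) (h , pos) keys≢ = rotations (Ω? g) (Ω? h)
      where
      rotations : Dec (Ω g) → Dec (Ω h) → Σ DG λ w → member W w ≡ true × Separates (g , pos) (h , pos) w
      rotations (yes g∈Ω) (yes h∈Ω) = ⊥-elim (keys≢ (trans (key-Ω g g∈Ω) (sym (key-Ω h h∈Ω))))
      rotations (no g∉Ω) (no h∉Ω) = ⊥-elim (keys≢ (trans (key-¬Ω g g∉Ω) (sym (key-¬Ω h h∉Ω))))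
      rotations (yes g∈Ω) (no h∉Ω) = let (k , k∈ , _) = reflection-over W injective e in (k , neg) , k∈ , inj₁ (g∈Ω , h∉Ω)
      rotations (no g∉Ω) (yes h∈Ω) = let (k , k∈ , _) = reflection-over W injective e in (k , neg) , k∈ , inj₂ (g∉Ω , h∈Ω)
    separator W injective (g , pos) (h , neg) _ with Ω? g
    ... | yes g∈Ω = let (k , k∈ , k~hg₀) = reflection-over W injective (h ∙ g₀) in
      (k , neg) , k∈ ,
      inj₁ (g∈Ω , λ h~k → g₀∉Ω (~-translate⁻ h g₀ (~-sym h (h ∙ g₀) (~-trans h k (h ∙ g₀) h~k k~hg₀))))
    ... | no g∉Ω = let (k , k∈ , k~h) = reflection-over W injective h in
      (k , neg) , k∈ , inj₂ (g∉Ω , ~-sym k h k~h)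
    separator W injective (g , neg) (h , pos) keys≢ =
      let (w , w∈ , separates) = separator W injective (h , pos) (g , neg) (λ same → keys≢ (sym same)) in
      w , w∈ , separates-swap separates
    separator W injective (g , neg) (h , neg) keys≢ =
      let (k , k∈ , k~g) = reflection-over W injective g in
      (k , neg) , k∈ , inj₁ (~-sym k g k~g , λ h~k → keys≢ (key-reflection⁻ g h (~-sym h g (~-trans h k g h~k k~g))))

    key-injective⇒resolving : ∀ W → KeyInjectiveOff W → Resolving W
    key-injective⇒resolving W injective u v same-profile with member W u in u∈ | member W v in v∈
    ... | true | _ = sym (dist-0 v u (trans (sym (equal u (member⇒∈W W u u∈))) (dist-self u)))
      where
      equal : ∀ w → w ∈W W → dist u w ≡ dist v w
      equal w w∈ = same-profile⇒equal-dist W u v same-profile w (∈W⇒member W w w∈)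
    ... | false | true = dist-0 u v (trans (same-profile⇒equal-dist W u v same-profile v v∈) (dist-self v))
    ... | false | false with key u ℕP.≟ key v
    ...   | yes same = injective u v u∈ v∈ same
    ...   | no keys≢ with separator W injective u v keys≢
    ...     | w , w∈ , separates = ⊥-elim (distinct separates)
      where
      equal : dist u w ≡ dist v w
      equal = same-profile⇒equal-dist W u v same-profile w w∈
      u≢w : ¬ u ≡ w
      u≢w = outside≢inside W u w u∈ w∈
      v≢w : ¬ v ≡ w
      v≢w = outside≢inside W v w v∈ w∈
      1≢2 : ¬ 1 ≡ 2
      1≢2 ()
      distinct : Separates u v w → Empty
      distinct (inj₁ (cu , ¬cv)) = 1≢2 (trans (sym (dist-1 u w u≢w cu)) (trans equal (dist-2 v w v≢w ¬cv)))
      distinct (inj₂ (¬cu , cv)) = 1≢2 (trans (sym (dist-1 v w v≢w cv)) (trans (sym equal) (dist-2 u w u≢w ¬cu)))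

-- Counting the resolving sets of Γ

module ResolvingSets {n : ℕ} (_∙_ : Fin n → Fin n → Fin n) (e : Fin n) (_⁻¹ : Fin n → Fin n)
    (isAbelianGroup : IsAbelianGroup _≡_ _∙_ e _⁻¹)
    (nonabelian : ¬ (∀ x y → Dihedral._·_ _∙_ _⁻¹ x y ≡ Dihedral._·_ _∙_ _⁻¹ y x))
    (r : ℕ) (1≤r : 1 ≤ r) (count-Ω : NumberOf (λ g → g ∙ g ≡ e) (2 ^ r))
    (b : ℕ) (b*q≡n : b * 2 ^ r ≡ n) where

  open IsAbelianGroup isAbelianGroup using (comm)
  open Counting
  open Subsets n
  open Involutions _∙_ e _⁻¹ isAbelianGroup
  open AbelianGroupProperties group using (\\-leftDividesˡ)
  open CommutingGraph _∙_ e _⁻¹ isAbelianGroup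
  open Dihedral _∙_ _⁻¹ using (DG; Resolving; NumResolving)

  q : ℕ
  q = 2 ^ r

  m : ℕ
  m = n ∸ q

  open ClosedForm m q

  2≤q : 2 ≤ q
  2≤q = power-of-two r 1≤r
    where
    power-of-two : ∀ k → 1 ≤ k → 2 ≤ 2 ^ k
    power-of-two (suc k) _ = ℕP.*-monoʳ-≤ 2 (ℕP.m^n>0 2 k)

  rotations-split : ∀ {k} → NumberOf (λ g → ¬ Ω g) k → q + k ≡ n
  rotations-split count-k = count-unique
    (count-cong (λ _ _ → tt) (λ g _ → decide (Ω? g)) refl (count-union (λ g g∈Ω g∉Ω → g∉Ω g∈Ω) count-Ω count-k))
    (count-all-Fin n)
    where
    decide : ∀ {g} → Dec (Ω g) → Ω g ⊎ ¬ Ω g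
    decide (yes g∈Ω) = inj₁ g∈Ω
    decide (no g∉Ω) = inj₂ g∉Ω

  count-¬Ω : NumberOf (λ g → ¬ Ω g) m
  count-¬Ω with count-decidable (count-all-Fin n) (λ g → ¬? (Ω? g))
  ... | k , count-k = count-cong (λ _ g∉Ω → g∉Ω) (λ _ g∉Ω → g∉Ω) k≡m count-k
    where
    k≡m : k ≡ m
    k≡m = trans (sym (ℕP.m+n∸m≡n q k)) (cong (_∸ q) (rotations-split count-k))

  q+m≡n : q + m ≡ n
  q+m≡n = rotations-split count-¬Ω

  involution : Σ (Fin n) λ ω → Ω ω × ¬ ω ≡ e
  involution = another FinP._≟_ count-Ω 2≤q e

  -- if Ω were all of G, every two elements of D(G) would commute
  non-involution : Σ (Fin n) λ g → ¬ Ω g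
  non-involution = FinP.¬∀⟶∃¬ n Ω Ω? λ all-Ω → nonabelian λ u w → Commuting⇒commute u w (all-commuting all-Ω u w)
    where
    all-commuting : (∀ g → Ω g) → ∀ u w → Commuting u w
    all-commuting all-Ω (g , pos) (h , pos) = tt
    all-commuting all-Ω (g , pos) (h , neg) = all-Ω g
    all-commuting all-Ω (g , neg) (h , pos) = all-Ω h
    all-commuting all-Ω (g , neg) (h , neg) = all-Ω (g ∙ (h ⁻¹))

  count-DG : NumberOf {DG} (λ _ → ⊤) (n + n)
  count-DG = count-cong (λ _ _ → tt) (λ { (g , pos) _ → inj₁ refl ; (g , neg) _ → inj₂ refl }) refl
    (count-union (λ { (g , pos) _ () ; (g , neg) () _ }) (sheet pos) (sheet neg))
    where
    sheet : (s : Sign) → NumberOf {DG} (λ x → proj₂ x ≡ s) n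
    sheet s = count-bijection (_, s) (λ _ _ → refl) (λ _ _ _ _ → cong proj₁)
      (λ { (g , .s) refl → g , tt , refl }) (count-all-Fin n)

  class-size : ℕ → ℕ
  class-size k = proj₁ (count-decidable count-DG (λ x → key x ℕP.≟ k))

  count-class : ∀ k → NumberOf (λ x → key x ≡ k) (class-size k)
  count-class k = proj₂ (count-decidable count-DG (λ x → key x ℕP.≟ k))

  count-rotation-class : {P : Fin n → Set} {k : ℕ} (j : ℕ) → j < 2 → (∀ g → P g ⇔ key (g , pos) ≡ j) →
    NumberOf P k → NumberOf (λ x → key x ≡ j) k
  count-rotation-class {P} j j<2 P⇔key = count-bijection (_, pos) (λ g → to (P⇔key g)) (λ _ _ _ _ → cong proj₁) onto
    where
    onto : ∀ x → key x ≡ j → Σ (Fin n) λ g → P g × (g , pos) ≡ x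
    onto (g , pos) key≡j = g , from (P⇔key g) key≡j , refl
    onto (g , neg) key≡j = ⊥-elim (ℕP.<⇒≱ j<2 (subst (2 ≤_) key≡j (s≤s (s≤s z≤n))))

  class-size-0 : class-size 0 ≡ m
  class-size-0 = count-unique (count-class 0) (count-rotation-class 0 (s≤s z≤n) ¬Ω⇔key0 count-¬Ω)
    where
    ¬Ω⇔key0 : ∀ g → (¬ Ω g) ⇔ key (g , pos) ≡ 0
    ¬Ω⇔key0 g = mk⇔ (key-¬Ω g) λ key≡0 g∈Ω → ℕP.1+n≢0 (trans (sym (key-Ω g g∈Ω)) key≡0)

  class-size-1 : class-size 1 ≡ q
  class-size-1 = count-unique (count-class 1) (count-rotation-class 1 (s≤s (s≤s z≤n)) Ω⇔key1 count-Ω)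
    where
    Ω⇔key1 : ∀ g → Ω g ⇔ key (g , pos) ≡ 1
    Ω⇔key1 g = mk⇔ (key-Ω g) λ key≡1 → key-rotation e g (trans (key-Ω e Ω-e) (sym key≡1)) Ω-e

  -- the twin class of a reflection (g , -1) is {(g w , -1) : w ∈ Ω}
  count-reflection-class : ∀ g → NumberOf (λ x → key x ≡ key (g , neg)) q
  count-reflection-class g =
    count-bijection (λ w → (g ∙ w) , neg) (λ w w∈Ω → key-reflection⁻ (g ∙ w) g (~-translate g w w∈Ω))
      (λ w w′ _ _ same → cancelˡ g w w′ (cong proj₁ same)) onto count-Ω
    where
    onto : ∀ x → key x ≡ key (g , neg) → Σ (Fin n) λ w → Ω w × ((g ∙ w) , neg) ≡ x
    onto (h , pos) same = ⊥-elim (key-rotation≢reflection h g same)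
    onto (h , neg) same =
      (g ⁻¹) ∙ h , subst Ω (comm h (g ⁻¹)) (key-reflection h g same) , cong (_, neg) (\\-leftDividesˡ g h)

  class-size-reflections : ∀ k → class-size (2 + k) ≡ 0 ⊎ class-size (2 + k) ≡ q
  class-size-reflections k with FinP.any? (λ g → toℕ (rep g) ℕP.≟ k)
  ... | yes (g , rep≡k) = inj₂ (count-unique (count-class (2 + k))
        (count-cong (λ _ p → trans p key≡) (λ _ p → trans p (sym key≡)) refl (count-reflection-class g)))
    where
    key≡ : key (g , neg) ≡ 2 + k
    key≡ = cong (2 +_) rep≡k
  ... | no none = inj₁ (count-unique (count-class (2 + k)) (count-none λ
        { (g , pos) key≡ → ℕP.<⇒≱ (s≤s (key-rotation≤1 g)) (subst (2 ≤_) (sym key≡) (s≤s (s≤s z≤n)))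
        ; (g , neg) key≡ → none (g , ℕP.suc-injective (ℕP.suc-injective key≡)) }))

  key-bound : ∀ x → key x < 2 + n
  key-bound (g , pos) = ℕP.≤-trans (s≤s (key-rotation≤1 g)) (s≤s (s≤s z≤n))
  key-bound (g , neg) = s≤s (s≤s (FinP.toℕ<n (rep g)))

  closed-form : Σ ℕ λ t → (∀ c → esym class-size (2 + n) c ≡ transversals t c) × total class-size (2 + n) ≡ m + t * q
  closed-form = esym-closed class-size class-size-0 later (suc n)
    where
    later : ∀ k → class-size (suc k) ≡ 0 ⊎ class-size (suc k) ≡ q
    later zero = inj₂ class-size-1
    later (suc k) = class-size-reflections k

  -- the number of classes of size q after the first one
  t : ℕ
  t = proj₁ closed-form

  -- every vertex lies in one of the classes, so m + t q = 2n
  m+tq≡2n : m + t * q ≡ n + n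
  m+tq≡2n = trans (sym (proj₂ (proj₂ closed-form)))
    (count-unique (Transversals.count-below key class-size count-class (2 + n))
      (count-cong (λ x _ → key-bound x) (λ _ _ → tt) refl count-DG))

  -- hence b + 1 classes have size q: the centre and the b reflection classes
  t≡b+1 : t ≡ b + 1
  t≡b+1 = ℕP.*-cancelʳ-≡ t (b + 1) q {{ℕ.>-nonZero (ℕP.≤-trans (s≤s z≤n) 2≤q)}}
    (ℕP.+-cancelˡ-≡ m _ _ (begin
      m + t * q        ≡⟨ m+tq≡2n ⟩
      n + n            ≡⟨ cong₂ _+_ (sym q+m≡n) (sym b*q≡n) ⟩
      (q + m) + b * q  ≡⟨ rearrange q m b ⟩
      m + (b + 1) * q  ∎))
    where
    open ≡-Reasoning
    rearrange : ∀ q m b → (q + m) + b * q ≡ m + (b + 1) * q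
    rearrange = solve-∀

  2*n≡n+n : 2 * n ≡ n + n
  2*n≡n+n = cong (n +_) (ℕP.+-identityʳ n)

  -- A set is resolving iff its complement is a partial transversal of the
  -- twin classes; complementation therefore counts the resolving sets.
  count-resolving : ∀ i → i ≤ 2 * n → NumResolving i (transversals (b + 1) (2 * n ∸ i))
  count-resolving i i≤2n =
    count-bijection complement into (λ W W′ _ _ same → complement-injective W W′ same) onto
      (count-cong (λ _ T → T) (λ _ T → T) count≡ (count-transversals (2 + n) (2 * n ∸ i)))
    where
    open Transversals key class-size count-class using (Transversal; count-transversals)
    count≡ : esym class-size (2 + n) (2 * n ∸ i) ≡ transversals (b + 1) (2 * n ∸ i)
    count≡ = trans (proj₁ (proj₂ closed-form) (2 * n ∸ i)) (cong (λ s → transversals s (2 * n ∸ i)) t≡b+1)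
    total-size : ∀ W → size (complement W) + size W ≡ 2 * n
    total-size W = trans (size-complement W) (sym 2*n≡n+n)
    into : ∀ W → Transversal (2 + n) (2 * n ∸ i) W → Resolving (complement W) × size (complement W) ≡ i
    into W (_ , injective , size≡) =
      key-injective⇒resolving (proj₁ involution) (proj₁ (proj₂ involution)) (proj₂ (proj₂ involution))
        (proj₁ non-involution) (proj₂ non-involution) (complement W)
        (λ x y x∉ y∉ → injective x y (outside-complement W x x∉) (outside-complement W y y∉)) ,
      trans (+⇒∸ (trans (cong (size (complement W) +_) (sym size≡)) (total-size W))) (ℕP.m∸[m∸n]≡n i≤2n)
    onto : ∀ W → Resolving W × size W ≡ i → Σ Sub λ V → Transversal (2 + n) (2 * n ∸ i) V × complement V ≡ W
    onto W (resolving , size≡i) =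
      complement W ,
      ((λ x _ → key-bound x) ,
       (λ x y x∈ y∈ → resolving⇒key-injective W resolving x y (inside-complement W x x∈) (inside-complement W y y∈)) ,
       +⇒∸ (trans (cong (size (complement W) +_) (sym size≡i)) (total-size W))) ,
      complement-involutive W

  recount : ∀ {i k l} → k ≡ l → NumResolving i k → NumResolving i l
  recount = count-cong (λ _ p → p) (λ _ p → p)

  b+2≤2n : b + 2 ≤ 2 * n
  b+2≤2n = subst (b + 2 ≤_) (sym 2*n≡n+n) (ℕP.+-mono-≤ b≤n (ℕP.≤-trans 2≤q q≤n))
    where
    q≤n : q ≤ n
    q≤n = subst (q ≤_) q+m≡n (ℕP.m≤m+n q m)
    b≤n : b ≤ n
    b≤n = subst (b ≤_) b*q≡n (ℕP.m≤m*n b q {{ℕ.>-nonZero (ℕP.≤-trans (s≤s z≤n) 2≤q)}})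

  2≤2n : 2 ≤ 2 * n
  2≤2n = ℕP.≤-trans (ℕP.m≤n+m 2 b) b+2≤2n

  small-sets : ∀ i → i < 2 * n ∸ b ∸ 2 → NumResolving i 0
  small-sets i i<2n∸b∸2
    with below-difference (2 * n) (b + 2) i (subst (i <_) (ℕP.∸-+-assoc (2 * n) b 2) i<2n∸b∸2)
  ... | i≤2n , b+2<2n∸i =
    recount (transversals-vanish (b + 1) (2 * n ∸ i) (subst (_< 2 * n ∸ i) (ℕP.+-suc b 1) b+2<2n∸i))
      (count-resolving i i≤2n)

  minimum-sets : NumResolving (2 * n ∸ b ∸ 2) (m * q ^ (b + 1))
  minimum-sets = recount count≡
    (count-resolving (2 * n ∸ b ∸ 2) (ℕP.≤-trans (ℕP.m∸n≤m (2 * n ∸ b) 2) (ℕP.m∸n≤m (2 * n) b)))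
    where
    open ≡-Reasoning
    count≡ : transversals (b + 1) (2 * n ∸ (2 * n ∸ b ∸ 2)) ≡ m * q ^ (b + 1)
    count≡ = begin
      transversals (b + 1) (2 * n ∸ (2 * n ∸ b ∸ 2))
        ≡⟨ cong (λ j → transversals (b + 1) (2 * n ∸ j)) (ℕP.∸-+-assoc (2 * n) b 2) ⟩
      transversals (b + 1) (2 * n ∸ (2 * n ∸ (b + 2)))
        ≡⟨ cong (transversals (b + 1)) (trans (ℕP.m∸[m∸n]≡n b+2≤2n) (ℕP.+-suc b 1)) ⟩
      transversals (b + 1) (suc (b + 1))               ≡⟨ transversals-top (b + 1) ⟩
      m * q ^ (b + 1)                                  ∎

  -- resolving sets of size i ≤ 2n − 2
  middle-sets : ∀ i → i ≤ 2 * n ∸ 2 →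
    NumResolving i (m * q ^ (2 * n ∸ i ∸ 1) * ((b + 1) C (2 * n ∸ i ∸ 1)) + q ^ (2 * n ∸ i) * ((b + 1) C (2 * n ∸ i)))
  middle-sets i i≤2n∸2 =
    recount (transversals-at (b + 1) (2 * n ∸ i) 1≤2n∸i) (count-resolving i (ℕP.m+n≤o⇒m≤o i i+2≤2n))
    where
    i+2≤2n : i + 2 ≤ 2 * n
    i+2≤2n = ℕP.m≤o∸n⇒m+n≤o i 2≤2n i≤2n∸2
    1≤2n∸i : 1 ≤ 2 * n ∸ i
    1≤2n∸i = ℕP.m+n≤o⇒m≤o∸n 1 (ℕP.≤-trans (ℕP.n≤1+n (suc i)) (subst (_≤ 2 * n) (ℕP.+-comm i 2) i+2≤2n))

  near-complete-sets : NumResolving (2 * n ∸ 1) (2 * n)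
  near-complete-sets = recount count≡ (count-resolving (2 * n ∸ 1) (ℕP.m∸n≤m (2 * n) 1))
    where
    open ≡-Reasoning
    count≡ : transversals (b + 1) (2 * n ∸ (2 * n ∸ 1)) ≡ 2 * n
    count≡ = begin
      transversals (b + 1) (2 * n ∸ (2 * n ∸ 1))
        ≡⟨ cong (transversals (b + 1)) (ℕP.m∸[m∸n]≡n (ℕP.≤-trans (s≤s z≤n) 2≤2n)) ⟩
      transversals (b + 1) 1                     ≡⟨ transversals-one (b + 1) ⟩
      m + (b + 1) * q                            ≡⟨ cong (λ s → m + s * q) t≡b+1 ⟨
      m + t * q                                  ≡⟨ m+tq≡2n ⟩
      n + n                                      ≡⟨ 2*n≡n+n ⟨
      2 * n                                      ∎

  complete-set : NumResolving (2 * n) 1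
  complete-set = recount (cong (transversals (b + 1)) (ℕP.n∸n≡0 (2 * n))) (count-resolving (2 * n) ℕP.≤-refl)


theorem4p4 : (n : ℕ) (_∙_ : Fin n → Fin n → Fin n) (e : Fin n) (_⁻¹ : Fin n → Fin n) →
    IsAbelianGroup _≡_ _∙_ e _⁻¹ →
    ¬ (∀ x y → Dihedral._·_ _∙_ _⁻¹ x y ≡ Dihedral._·_ _∙_ _⁻¹ y x) →
    (r : ℕ) → 1 ≤ r → NumberOf (λ g → g ∙ g ≡ e) (2 ^ r) →
    (b : ℕ) → b * 2 ^ r ≡ n →
    (∀ i → i < 2 * n ∸ b ∸ 2 → Dihedral.NumResolving _∙_ _⁻¹ i 0)
    × Dihedral.NumResolving _∙_ _⁻¹ (2 * n ∸ b ∸ 2) ((n ∸ 2 ^ r) * (2 ^ r) ^ (b + 1))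
    × (∀ i → 2 * n ∸ b ∸ 1 ≤ i → i ≤ 2 * n ∸ 2 →
        Dihedral.NumResolving _∙_ _⁻¹ i
          ((n ∸ 2 ^ r) * (2 ^ r) ^ (2 * n ∸ i ∸ 1) * ((b + 1) C (2 * n ∸ i ∸ 1))
            + (2 ^ r) ^ (2 * n ∸ i) * ((b + 1) C (2 * n ∸ i))))
    × Dihedral.NumResolving _∙_ _⁻¹ (2 * n ∸ 1) (2 * n)
    × Dihedral.NumResolving _∙_ _⁻¹ (2 * n) 1
theorem4p4 n _∙_ e _⁻¹ isAbelianGroup nonabelian r 1≤r count-Ω b b*q≡n =
  small-sets , minimum-sets , (λ i _ → middle-sets i) , near-complete-sets , complete-set
  where
  open ResolvingSets _∙_ e _⁻¹ isAbelianGroup nonabelian r 1≤r count-Ω b b*q≡n
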